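{- For $n\ge1$, let $L'_{n+1}$ be the $n\times n$ matrix with entries $(L'_{n+1})_{ii}=2n-i+1$, $(L'_{n+1})_{ij}=-1$ for $j<i$, and $(L'_{n+1})_{ij}=-2$ for $j>i$. Then $\det(L'_{n+1})=n!\,C_{n+1}$, where $C_m=\frac{1}{m+1}\binom{2m}{m}$ is the $m$-th Catalan number.
   Context: $L'_{n+1}$ is the weighted Laplacian of the directed multigraph $G_{A_n}$ with row and column $n+1$ removed. $G_{A_n}$ has vertices $v_1,\dots,v_{n+1}$, a directed edge $v_i\to v_{n+1}$ for each $i\in[n]$, and directed edges $v_i\to v_j$, $v_j\to v_i$ for all $i\ne j$ in $[n]$. Each directed edge $v_i\to v_j$ gets weight $1$ if $i>j$ and weight $2$ if $i<j$ (including $j=n+1$); the weighted Laplacian has diagonal entry $(i,i)$ equal to the total weight of edges leaving $v_i$ and off-diagonal entry $(i,j)$ equal to minus the weight of the edge $v_i\to v_j$. This determinant equals the number of signed minimal factorizations of a Coxeter element of $A_n$. -}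

module Defs where

open import Data.Nat as ℕ using (ℕ; zero; suc; _∸_)
open import Data.Nat.Combinatorics using (_C_)
open import Data.Nat.DivMod using (_/_)
open import Data.Integer as ℤ using (ℤ; +_; -_; _+_; _*_)
open import Data.Fin using (Fin; zero; suc; toℕ; punchIn)
open import Data.Nat.Base using (_<ᵇ_)
open import Data.Bool using (if_then_else_)

Matrix : ℕ → Set
Matrix n = Fin n → Fin n → ℤ

∑ : (n : ℕ) → (Fin n → ℤ) → ℤ
∑ zero    f = + 0
∑ (suc n) f = f zero + ∑ n (λ j → f (suc j))

sgn : ℕ → ℤ
sgn zero    = + 1
sgn (suc k) = - sgn k

minor : ∀ {n} → Matrix (suc n) → Fin (suc n) → Matrix n
minor A j r c = A (suc r) (punchIn j c)

det : (n : ℕ) → Matrix n → ℤ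
det zero    A = + 1
det (suc n) A = ∑ (suc n) (λ j → sgn (toℕ j) * (A zero j * det n (minor A j)))

-- the matrix L'_{n+1}; with 1-based indices i = toℕ i + 1, j = toℕ j + 1:
-- diagonal 2n - i + 1, entry -1 if j < i, entry -2 if j > i
L' : (n : ℕ) → Matrix n
L' n i j =
  if toℕ j <ᵇ toℕ i then - (+ 1)
  else if toℕ i <ᵇ toℕ j then - (+ 2)
  else + (2 ℕ.* n ∸ toℕ i)

catalan : ℕ → ℕ
catalan m = ((2 ℕ.* m) C m) / suc m

{-# OPTIONS --safe #-}
-- Replace the diagonal of L'_{n+1} by arbitrary integers d₀, …, d_{n-1}, keeping −1 below and
-- −2 above it. Subtracting from each of the first n − 1 columns its right neighbour leaves the
-- determinant unchanged, since the determinant is linear in a column and vanishes when two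
-- adjacent columns agree. The first row becomes (d₀ + 2, 0, …, 0, −2): the minor of d₀ + 2 is
-- the same reduced matrix for d₁, …, d_{n-1}, and the minor of −2 is triangular with diagonal
-- −1 − d₁, …, −1 − d_{n-1}. By induction the determinant is 2 ∏ (dᵢ + 1) − ∏ (dᵢ + 2). For dᵢ = 2n − i the
-- products are (2n+1)!/(n+1)! and (2n+2)!/(n+2)!, and 2 (2n+1)!/(n+2)! = n! C_{n+1}; the
-- division defining C_{n+1} is exact because C_{n+1} = binom(2n+2, n+1) − binom(2n+2, n+2).
module Submission where

open import Defs

module Determinant where

  open import Data.Nat using (ℕ; zero; suc)
  open import Data.Nat.Properties as ℕ using (1+n≢n)
  open import Data.Integer using (ℤ; +_; -_; _+_; _*_; _-_)
  open import Data.Integer.Properties using (*-zeroʳ; *-identityˡ; +-identityˡ; +-identityʳ; +-comm)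
  open import Data.Integer.Tactic.RingSolver using (solve-∀)
  open import Data.Fin using (Fin; zero; suc; toℕ; punchIn; punchOut)
  open import Data.Fin.Properties using (_≟_; suc-injective; punchIn-punchOut; punchInᵢ≢i; punchIn-injective)
  open import Data.Empty using (⊥-elim)
  open import Data.Sum using (_⊎_; inj₁; inj₂)
  open import Data.Product using (_×_; _,_)
  open import Function using (_∘_)
  open import Relation.Nullary using (yes; no)
  open import Relation.Binary.PropositionalEquality
  open ≡-Reasoning

  ∑-cong : ∀ n {f g : Fin n → ℤ} → (∀ j → f j ≡ g j) → ∑ n f ≡ ∑ n g
  ∑-cong zero    f≗g = refl
  ∑-cong (suc n) f≗g = cong₂ _+_ (f≗g zero) (∑-cong n (f≗g ∘ suc))

  ∑-linear : ∀ n (s t : ℤ) (f g : Fin n → ℤ) →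
             ∑ n (λ j → s * f j + t * g j) ≡ s * ∑ n f + t * ∑ n g
  ∑-linear zero    s t f g = sym (cong₂ _+_ (*-zeroʳ s) (*-zeroʳ t))
  ∑-linear (suc n) s t f g = begin
    (s * f zero + t * g zero) + ∑ n (λ j → s * f (suc j) + t * g (suc j))
      ≡⟨ cong (_+_ (s * f zero + t * g zero)) (∑-linear n s t (f ∘ suc) (g ∘ suc)) ⟩
    (s * f zero + t * g zero) + (s * ∑ n (f ∘ suc) + t * ∑ n (g ∘ suc))
      ≡⟨ interchange s t (f zero) (g zero) _ _ ⟩
    s * ∑ (suc n) f + t * ∑ (suc n) g ∎
    where
    interchange : ∀ s t a b x y → (s * a + t * b) + (s * x + t * y) ≡ s * (a + x) + t * (b + y)
    interchange = solve-∀

  ∑-zero : ∀ n (f : Fin n → ℤ) → (∀ j → f j ≡ + 0) → ∑ n f ≡ + 0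
  ∑-zero zero    f f≗0 = refl
  ∑-zero (suc n) f f≗0 = cong₂ _+_ (f≗0 zero) (∑-zero n (f ∘ suc) (f≗0 ∘ suc))

  ∑-single : ∀ n (f : Fin n → ℤ) (c : Fin n) → (∀ j → j ≢ c → f j ≡ + 0) → ∑ n f ≡ f c
  ∑-single (suc n) f zero f≗0 = begin
    f zero + ∑ n (f ∘ suc) ≡⟨ cong (_+_ (f zero)) (∑-zero n (f ∘ suc) (λ j → f≗0 (suc j) λ ())) ⟩
    f zero + + 0           ≡⟨ +-identityʳ (f zero) ⟩
    f zero                 ∎
  ∑-single (suc n) f (suc c) f≗0 = trans
    (cong₂ _+_ (f≗0 zero λ ()) (∑-single n (f ∘ suc) c (λ j j≢c → f≗0 (suc j) (j≢c ∘ suc-injective))))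
    (+-identityˡ (f (suc c)))

  ∑-pair : ∀ n (f : Fin n → ℤ) (c c' : Fin n) → c ≢ c' →
           (∀ j → j ≢ c → j ≢ c' → f j ≡ + 0) → ∑ n f ≡ f c + f c'
  ∑-pair (suc n) f zero zero c≢c' f≗0 = ⊥-elim (c≢c' refl)
  ∑-pair (suc n) f zero (suc c') c≢c' f≗0 =
    cong (_+_ (f zero)) (∑-single n (f ∘ suc) c' (λ j j≢c' → f≗0 (suc j) (λ ()) (j≢c' ∘ suc-injective)))
  ∑-pair (suc n) f (suc c) zero c≢c' f≗0 = begin
    f zero + ∑ n (f ∘ suc)
      ≡⟨ cong (_+_ (f zero)) (∑-single n (f ∘ suc) c (λ j j≢c → f≗0 (suc j) (j≢c ∘ suc-injective) (λ ()))) ⟩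
    f zero + f (suc c)     ≡⟨ +-comm (f zero) (f (suc c)) ⟩
    f (suc c) + f zero     ∎
  ∑-pair (suc n) f (suc c) (suc c') c≢c' f≗0 = trans
    (cong₂ _+_ (f≗0 zero (λ ()) (λ ()))
      (∑-pair n (f ∘ suc) c c' (c≢c' ∘ cong suc)
        (λ j j≢c j≢c' → f≗0 (suc j) (j≢c ∘ suc-injective) (j≢c' ∘ suc-injective))))
    (+-identityˡ _)

  expansionTerm : ∀ {n} → Matrix (suc n) → Fin (suc n) → ℤ
  expansionTerm {n} A j = sgn (toℕ j) * (A zero j * det n (minor A j))

  expansionTerm-entry-zero : ∀ {n} (A : Matrix (suc n)) j → A zero j ≡ + 0 → expansionTerm A j ≡ + 0
  expansionTerm-entry-zero {n} A j A₀ⱼ≡0 =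
    trans (cong (λ a → sgn (toℕ j) * (a * det n (minor A j))) A₀ⱼ≡0)
          (annihilate (sgn (toℕ j)) (det n (minor A j)))
    where
    annihilate : ∀ g d → g * (+ 0 * d) ≡ + 0
    annihilate = solve-∀

  expansionTerm-minor-zero : ∀ {n} (A : Matrix (suc n)) j → det n (minor A j) ≡ + 0 → expansionTerm A j ≡ + 0
  expansionTerm-minor-zero A j minor≡0 =
    trans (cong (λ d → sgn (toℕ j) * (A zero j * d)) minor≡0) (annihilate (sgn (toℕ j)) (A zero j))
    where
    annihilate : ∀ g a → g * (a * + 0) ≡ + 0
    annihilate = solve-∀

  det-cong : ∀ n {A B : Matrix n} → (∀ r c → A r c ≡ B r c) → det n A ≡ det n B
  det-cong zero    A≗B = refl
  det-cong (suc n) A≗B = ∑-cong (suc n) λ j →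
    cong₂ (λ a d → sgn (toℕ j) * (a * d)) (A≗B zero j) (det-cong n (λ r c → A≗B (suc r) (punchIn j c)))

  det-linear-column : ∀ n (A B C : Matrix n) (k : Fin n) (s t : ℤ) →
    (∀ r c → c ≢ k → A r c ≡ C r c) → (∀ r c → c ≢ k → B r c ≡ C r c) →
    (∀ r → C r k ≡ s * A r k + t * B r k) → det n C ≡ s * det n A + t * det n B
  det-linear-column (suc n) A B C k s t A≈C B≈C Cₖ =
    trans (∑-cong (suc n) termwise) (∑-linear (suc n) s t (expansionTerm A) (expansionTerm B))
    where
    minor-agrees : ∀ {A'} → (∀ r c → c ≢ k → A' r c ≡ C r c) → ∀ {j} (j≢k : j ≢ k) →
                   ∀ r c → c ≢ punchOut j≢k → minor A' j r c ≡ minor C j r c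
    minor-agrees A'≈C {j} j≢k r c c≢k' =
      A'≈C (suc r) (punchIn j c) (λ eq → c≢k' (punchIn-injective j c _ (trans eq (sym (punchIn-punchOut j≢k)))))

    termwise : ∀ j → expansionTerm C j ≡ s * expansionTerm A j + t * expansionTerm B j
    termwise j with j ≟ k
    ... | yes refl = begin
      g * (C zero j * det n (minor C j))
        ≡⟨ cong (λ a → g * (a * det n (minor C j))) (Cₖ zero) ⟩
      g * ((s * A zero j + t * B zero j) * det n (minor C j))
        ≡⟨ distrib g s t (A zero j) (B zero j) _ ⟩
      s * (g * (A zero j * det n (minor C j))) + t * (g * (B zero j * det n (minor C j)))
        ≡⟨ cong₂ (λ x y → s * (g * (A zero j * x)) + t * (g * (B zero j * y))) (minor≡ A≈C) (minor≡ B≈C) ⟨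
      s * expansionTerm A j + t * expansionTerm B j ∎
      where
      g = sgn (toℕ j)
      minor≡ : ∀ {A'} → (∀ r c → c ≢ j → A' r c ≡ C r c) → det n (minor A' j) ≡ det n (minor C j)
      minor≡ A'≈C = det-cong n (λ r c → A'≈C (suc r) (punchIn j c) (punchInᵢ≢i j c))
      distrib : ∀ g s t a b d → g * ((s * a + t * b) * d) ≡ s * (g * (a * d)) + t * (g * (b * d))
      distrib = solve-∀
    ... | no j≢k = begin
      g * (C zero j * det n (minor C j))
        ≡⟨ cong₂ (λ a x → g * (a * x)) (A≈C zero j j≢k) (sym column-linear) ⟨
      g * (A zero j * (s * det n (minor A j) + t * det n (minor B j)))
        ≡⟨ distrib g s t (A zero j) _ _ ⟩
      s * expansionTerm A j + t * (g * (A zero j * det n (minor B j)))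
        ≡⟨ cong (λ b → s * expansionTerm A j + t * (g * (b * det n (minor B j))))
                (trans (A≈C zero j j≢k) (sym (B≈C zero j j≢k))) ⟩
      s * expansionTerm A j + t * expansionTerm B j ∎
      where
      g = sgn (toℕ j)
      column-linear : det n (minor C j) ≡ s * det n (minor A j) + t * det n (minor B j)
      column-linear = det-linear-column n (minor A j) (minor B j) (minor C j) (punchOut j≢k) s t
        (minor-agrees A≈C j≢k) (minor-agrees B≈C j≢k)
        (λ r → subst (λ c → C (suc r) c ≡ s * A (suc r) c + t * B (suc r) c)
                     (sym (punchIn-punchOut j≢k)) (Cₖ (suc r)))
      distrib : ∀ g s t a x y → g * (a * (s * x + t * y)) ≡ s * (g * (a * x)) + t * (g * (a * y))
      distrib = solve-∀

  det-zero-column : ∀ n (A : Matrix n) (k : Fin n) → (∀ r → A r k ≡ + 0) → det n A ≡ + 0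
  det-zero-column n A k Aₖ≡0 = begin
    det n A                       ≡⟨ det-linear-column n A A A k (+ 0) (+ 0) (λ _ _ _ → refl) (λ _ _ _ → refl)
                                       (λ r → trans (Aₖ≡0 r) (zero-combination (A r k))) ⟩
    + 0 * det n A + + 0 * det n A ≡⟨ zero-combination (det n A) ⟨
    + 0                           ∎
    where
    zero-combination : ∀ a → + 0 ≡ + 0 * a + + 0 * a
    zero-combination = solve-∀

  det-first-column-zero-below : ∀ n (A : Matrix (suc n)) → (∀ r → A (suc r) zero ≡ + 0) →
                          det (suc n) A ≡ A zero zero * det n (minor A zero)
  det-first-column-zero-below n A A₀≡0 = begin
    ∑ (suc n) (expansionTerm A)          ≡⟨ ∑-single (suc n) (expansionTerm A) zero vanishes ⟩
    + 1 * (A zero zero * det n (minor A zero)) ≡⟨ *-identityˡ _ ⟩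
    A zero zero * det n (minor A zero)   ∎
    where
    vanishes : ∀ j → j ≢ zero → expansionTerm A j ≡ + 0
    vanishes zero    0≢0 = ⊥-elim (0≢0 refl)
    vanishes (suc j) j≢0 = expansionTerm-minor-zero A (suc j) minor-vanishes
      where
      minor-vanishes : det n (minor A (suc j)) ≡ + 0
      minor-vanishes = det-zero-column n (minor A (suc j)) (punchOut j≢0)
        (λ r → trans (cong (A (suc r)) (punchIn-punchOut j≢0)) (A₀≡0 r))

  Adjacent : ∀ {n} → Fin n → Fin n → Set
  Adjacent c c' = toℕ c' ≡ suc (toℕ c)

  adjacent⇒≢ : ∀ {n} {c c' : Fin n} → Adjacent c c' → c ≢ c'
  adjacent⇒≢ adj refl = 1+n≢n (sym adj)

  punchOut-adjacent : ∀ {n} {j c c' : Fin (suc n)} (j≢c : j ≢ c) (j≢c' : j ≢ c') →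
                      Adjacent c c' → Adjacent (punchOut j≢c) (punchOut j≢c')
  punchOut-adjacent {_}     {zero}        {zero}  j≢c _ _ = ⊥-elim (j≢c refl)
  punchOut-adjacent {_}     {zero}        {suc c} {suc c'} _ _ adj = ℕ.suc-injective adj
  punchOut-adjacent {suc n} {suc zero}    {zero}  {suc zero} _ j≢c' _ = ⊥-elim (j≢c' refl)
  punchOut-adjacent {suc (suc n)} {suc (suc j)} {zero} {suc zero} _ _ _ = refl
  punchOut-adjacent {suc n} {suc j}       {suc c} {suc c'} j≢c j≢c' adj =
    cong suc (punchOut-adjacent (j≢c ∘ cong suc) (j≢c' ∘ cong suc) (ℕ.suc-injective adj))

  punchIn-adjacent : ∀ {n} {c c' : Fin (suc n)} → Adjacent c c' → ∀ x →
                     punchIn c' x ≡ punchIn c x ⊎ (punchIn c' x ≡ c × punchIn c x ≡ c')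
  punchIn-adjacent {_} {zero}  {suc zero} _ zero    = inj₂ (refl , refl)
  punchIn-adjacent {_} {zero}  {suc zero} _ (suc x) = inj₁ refl
  punchIn-adjacent {_} {suc c} {suc c'}   _ zero    = inj₁ refl
  punchIn-adjacent {_} {suc c} {suc c'} adj (suc x) with punchIn-adjacent (ℕ.suc-injective adj) x
  ... | inj₁ eq          = inj₁ (cong suc eq)
  ... | inj₂ (eq , eq')  = inj₂ (cong suc eq , cong suc eq')

  det-adjacent-equal-columns : ∀ n (A : Matrix n) {c c' : Fin n} → Adjacent c c' →
                               (∀ r → A r c ≡ A r c') → det n A ≡ + 0
  det-adjacent-equal-columns (suc n) A {c} {c'} adj Ac≡Ac' = begin
    ∑ (suc n) (expansionTerm A)
      ≡⟨ ∑-pair (suc n) (expansionTerm A) c c' (adjacent⇒≢ adj) vanishes ⟩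
    expansionTerm A c + expansionTerm A c'
      ≡⟨ cong₂ (λ g a → expansionTerm A c + g * (a * det n (minor A c'))) (cong sgn adj) (sym (Ac≡Ac' zero)) ⟩
    g * (a * det n (minor A c)) + - g * (a * det n (minor A c'))
      ≡⟨ cong (λ d → g * (a * det n (minor A c)) + - g * (a * d)) (det-cong n minors-agree) ⟩
    g * (a * det n (minor A c)) + - g * (a * det n (minor A c))
      ≡⟨ cancel g a _ ⟩
    + 0 ∎
    where
    g = sgn (toℕ c)
    a = A zero c
    cancel : ∀ g a d → g * (a * d) + - g * (a * d) ≡ + 0
    cancel = solve-∀
    minors-agree : ∀ r x → minor A c' r x ≡ minor A c r x
    minors-agree r x with punchIn-adjacent adj x
    ... | inj₁ eq         = cong (A (suc r)) eq
    ... | inj₂ (eq , eq') = trans (cong (A (suc r)) eq) (trans (Ac≡Ac' (suc r)) (cong (A (suc r)) (sym eq')))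
    vanishes : ∀ j → j ≢ c → j ≢ c' → expansionTerm A j ≡ + 0
    vanishes j j≢c j≢c' = expansionTerm-minor-zero A j minor-vanishes
      where
      minor-vanishes : det n (minor A j) ≡ + 0
      minor-vanishes = det-adjacent-equal-columns n (minor A j) (punchOut-adjacent j≢c j≢c' adj)
        (λ r → trans (cong (A (suc r)) (punchIn-punchOut j≢c))
                     (trans (Ac≡Ac' (suc r)) (cong (A (suc r)) (sym (punchIn-punchOut j≢c')))))

  det-subtract-adjacent-column : ∀ n (A A' : Matrix n) {k k' : Fin n} → Adjacent k k' →
    (∀ r c → c ≢ k → A' r c ≡ A r c) → (∀ r → A' r k ≡ A r k - A r k') → det n A' ≡ det n A
  det-subtract-adjacent-column n A A' {k} {k'} adj A'≈A A'ₖ = begin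
    det n A'
      ≡⟨ det-linear-column n A repeated A' k (+ 1) (- + 1) A≈A' repeated≈A' A'ₖ-combination ⟩
    + 1 * det n A + - + 1 * det n repeated ≡⟨ cong (λ d → + 1 * det n A + - + 1 * d) repeated-singular ⟩
    + 1 * det n A + - + 1 * + 0            ≡⟨ drop-zero (det n A) ⟩
    det n A                                ∎
    where
    as-combination : ∀ a b → a - b ≡ + 1 * a + - + 1 * b
    as-combination = solve-∀
    drop-zero : ∀ a → + 1 * a + - + 1 * + 0 ≡ a
    drop-zero = solve-∀
    repeated : Matrix n
    repeated r c with c ≟ k
    ... | yes _ = A r k'
    ... | no  _ = A r c
    repeated-column : ∀ {r} → repeated r k ≡ A r k'
    repeated-column with k ≟ k
    ... | yes _   = refl
    ... | no  k≢k = ⊥-elim (k≢k refl)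
    repeated-next : ∀ {r} → repeated r k' ≡ A r k'
    repeated-next with k' ≟ k
    ... | yes k'≡k = ⊥-elim (adjacent⇒≢ adj (sym k'≡k))
    ... | no  _    = refl
    repeated≈A' : ∀ r c → c ≢ k → repeated r c ≡ A' r c
    repeated≈A' r c c≢k with c ≟ k
    ... | yes c≡k = ⊥-elim (c≢k c≡k)
    ... | no  _   = sym (A'≈A r c c≢k)
    repeated-singular : det n repeated ≡ + 0
    repeated-singular = det-adjacent-equal-columns n repeated adj (λ r → trans repeated-column (sym repeated-next))
    A≈A' : ∀ r c → c ≢ k → A r c ≡ A' r c
    A≈A' r c c≢k = sym (A'≈A r c c≢k)
    A'ₖ-combination : ∀ r → A' r k ≡ + 1 * A r k + - + 1 * repeated r k
    A'ₖ-combination r = begin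
      A' r k                         ≡⟨ A'ₖ r ⟩
      A r k - A r k'                 ≡⟨ as-combination (A r k) (A r k') ⟩
      + 1 * A r k + - + 1 * A r k'   ≡⟨ cong (λ b → + 1 * A r k + - + 1 * b) repeated-column ⟨
      + 1 * A r k + - + 1 * repeated r k ∎

module ColumnReduction where

  open Determinant
  open import Data.Nat using (ℕ; zero; suc; _<_; _≤_; z≤n; s≤s; _<ᵇ_)
  open import Data.Nat.Properties using (<-cmp; ≤-refl; <⇒≤; n≤1+n; n<1+n; <-trans)
  open import Data.Integer using (ℤ; +_; -_; _+_; _*_; _-_)
  open import Data.Integer.Properties using (*-identityˡ)
  open import Data.Integer.Tactic.RingSolver using (solve-∀)
  open import Data.Bool using (true; false; if_then_else_)
  open import Data.Fin using (Fin; zero; suc; toℕ; fromℕ; fromℕ<; punchIn)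
  open import Data.Fin.Properties using (toℕ-fromℕ; toℕ-fromℕ<; toℕ<n; toℕ-injective)
  open import Data.Empty using (⊥-elim)
  open import Function using (_∘_)
  open import Relation.Binary using (tri<; tri≈; tri>)
  open import Relation.Binary.PropositionalEquality
  open ≡-Reasoning

  <⇒<ᵇ≡true : ∀ m n → m < n → (m <ᵇ n) ≡ true
  <⇒<ᵇ≡true zero    (suc n) _         = refl
  <⇒<ᵇ≡true (suc m) (suc n) (s≤s m<n) = <⇒<ᵇ≡true m n m<n

  ≥⇒<ᵇ≡false : ∀ m n → n ≤ m → (m <ᵇ n) ≡ false
  ≥⇒<ᵇ≡false m       zero    _         = refl
  ≥⇒<ᵇ≡false (suc m) (suc n) (s≤s n≤m) = ≥⇒<ᵇ≡false m n n≤m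

  ≢fromℕ⇒< : ∀ {m} (j : Fin (suc m)) → j ≢ fromℕ m → toℕ j < m
  ≢fromℕ⇒< {zero}  zero    j≢0 = ⊥-elim (j≢0 refl)
  ≢fromℕ⇒< {suc m} zero    _   = s≤s z≤n
  ≢fromℕ⇒< {suc m} (suc j) j≢m = s≤s (≢fromℕ⇒< j (j≢m ∘ cong suc))

  toℕ-punchIn-fromℕ : ∀ {m} (c : Fin m) → toℕ (punchIn (fromℕ m) c) ≡ toℕ c
  toℕ-punchIn-fromℕ zero    = refl
  toℕ-punchIn-fromℕ (suc c) = cong suc (toℕ-punchIn-fromℕ c)

  laplacianEntry : (ℕ → ℤ) → ℕ → ℕ → ℤ
  laplacianEntry d i j = if j <ᵇ i then - + 1 else if i <ᵇ j then - + 2 else d i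

  differenceEntry : (ℕ → ℤ) → ℕ → ℕ → ℤ
  differenceEntry d i j = laplacianEntry d i j - laplacianEntry d i (suc j)

  Laplacian : (ℕ → ℤ) → (n : ℕ) → Matrix n
  Laplacian d n i j = laplacianEntry d (toℕ i) (toℕ j)

  reducedEntry : (ℕ → ℤ) → ℕ → ℕ → ℕ → ℤ
  reducedEntry d k i j = if j <ᵇ k then differenceEntry d i j else laplacianEntry d i j

  Reduced : (ℕ → ℤ) → (n k : ℕ) → Matrix n
  Reduced d n k i j = reducedEntry d k (toℕ i) (toℕ j)

  det-Reduced-suc : ∀ d n k → suc k < n → det n (Reduced d n (suc k)) ≡ det n (Reduced d n k)
  det-Reduced-suc d n k k+1<n =
    det-subtract-adjacent-column n (Reduced d n k) (Reduced d n (suc k)) {col} {next} adjacent unchanged subtracted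
    where
    k<n = <-trans (n<1+n k) k+1<n
    col next : Fin n
    col  = fromℕ< k<n
    next = fromℕ< k+1<n
    adjacent : Adjacent col next
    adjacent = trans (toℕ-fromℕ< k+1<n) (cong suc (sym (toℕ-fromℕ< k<n)))
    unchanged : ∀ r c → c ≢ col → Reduced d n (suc k) r c ≡ Reduced d n k r c
    unchanged r c c≢k with <-cmp (toℕ c) k
    ... | tri< c<k _ _
        rewrite <⇒<ᵇ≡true (toℕ c) k c<k | <⇒<ᵇ≡true (toℕ c) (suc k) (<-trans c<k (n<1+n k)) = refl
    ... | tri≈ _ c≡k _ = ⊥-elim (c≢k (toℕ-injective (trans c≡k (sym (toℕ-fromℕ< k<n)))))
    ... | tri> _ _ c>k
        rewrite ≥⇒<ᵇ≡false (toℕ c) k (<⇒≤ c>k) | ≥⇒<ᵇ≡false (toℕ c) (suc k) c>k = refl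
    subtracted : ∀ r → Reduced d n (suc k) r col ≡ Reduced d n k r col - Reduced d n k r next
    subtracted r rewrite toℕ-fromℕ< k<n | toℕ-fromℕ< k+1<n
      | <⇒<ᵇ≡true k (suc k) (n<1+n k) | ≥⇒<ᵇ≡false k k ≤-refl | ≥⇒<ᵇ≡false (suc k) k (n≤1+n k) = refl

  det-Reduced : ∀ d n k → k < n → det n (Reduced d n k) ≡ det n (Laplacian d n)
  det-Reduced d n zero    _     = refl
  det-Reduced d n (suc k) k+1<n =
    trans (det-Reduced-suc d n k k+1<n) (det-Reduced d n k (<-trans (n<1+n k) k+1<n))

  ∏ : ℕ → (ℕ → ℤ) → ℤ
  ∏ zero    f = + 1
  ∏ (suc k) f = f 0 * ∏ k (f ∘ suc)

  sgn-∏-negate : ∀ k (y : ℕ → ℤ) → sgn k * ∏ k (λ i → - + 1 - y i) ≡ ∏ k (λ i → y i + + 1)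
  sgn-∏-negate zero    y = refl
  sgn-∏-negate (suc k) y = begin
    - sgn k * ((- + 1 - y 0) * ∏ k (λ i → - + 1 - y (suc i)))
      ≡⟨ negate-factor (sgn k) (y 0) _ ⟩
    (y 0 + + 1) * (sgn k * ∏ k (λ i → - + 1 - y (suc i)))
      ≡⟨ cong ((y 0 + + 1) *_) (sgn-∏-negate k (y ∘ suc)) ⟩
    ∏ (suc k) (λ i → y i + + 1) ∎
    where
    negate-factor : ∀ g a p → - g * ((- + 1 - a) * p) ≡ (a + + 1) * (g * p)
    negate-factor = solve-∀

  SubdiagonalDifferences : (ℕ → ℤ) → (m : ℕ) → Matrix m
  SubdiagonalDifferences d m r c = differenceEntry d (suc (toℕ r)) (toℕ c)

  det-SubdiagonalDifferences : ∀ m d → det m (SubdiagonalDifferences d m) ≡ ∏ m (λ i → - + 1 - d (suc i))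
  det-SubdiagonalDifferences zero    d = refl
  det-SubdiagonalDifferences (suc m) d =
    trans (det-first-column-zero-below m (SubdiagonalDifferences d (suc m)) (λ r → refl))
          (cong ((- + 1 - d 1) *_) (det-SubdiagonalDifferences m (d ∘ suc)))

  det-fully-Reduced : ∀ m d → det (suc m) (Reduced d (suc m) m) ≡
                     + 2 * ∏ (suc m) (λ i → d i + + 1) - ∏ (suc m) (λ i → d i + + 2)
  det-fully-Reduced zero    d = closed-form (d 0)
    where
    closed-form : ∀ a → + 1 * (a * + 1) + + 0 ≡ + 2 * ((a + + 1) * + 1) - (a + + 2) * + 1
    closed-form = solve-∀
  det-fully-Reduced (suc m) d = begin
    det (suc (suc m)) A
      ≡⟨ ∑-pair (suc (suc m)) (expansionTerm A) zero last (λ ()) vanishes ⟩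
    expansionTerm A zero + expansionTerm A last
      ≡⟨ cong₂ _+_ first-term last-term ⟩
    (d 0 - - + 2) * (+ 2 * P₁ - P₂) + - + 2 * P₁
      ≡⟨ recombine (d 0) P₁ P₂ ⟩
    + 2 * ∏ (suc (suc m)) (λ i → d i + + 1) - ∏ (suc (suc m)) (λ i → d i + + 2) ∎
    where
    A = Reduced d (suc (suc m)) (suc m)
    last = fromℕ (suc m)
    P₁ = ∏ (suc m) (λ i → d (suc i) + + 1)
    P₂ = ∏ (suc m) (λ i → d (suc i) + + 2)
    recombine : ∀ a p q → (a - - + 2) * (+ 2 * p - q) + - + 2 * p ≡ + 2 * ((a + + 1) * p) - (a + + 2) * q
    recombine = solve-∀

    vanishes : ∀ j → j ≢ zero → j ≢ last → expansionTerm A j ≡ + 0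
    vanishes zero    0≢0 _      = ⊥-elim (0≢0 refl)
    vanishes (suc j) _   j≢last = expansionTerm-entry-zero A (suc j) first-row-zero
      where
      first-row-zero : A zero (suc j) ≡ + 0
      first-row-zero rewrite <⇒<ᵇ≡true (toℕ j) m (≢fromℕ⇒< j (j≢last ∘ cong suc)) = refl

    first-term : expansionTerm A zero ≡ (d 0 - - + 2) * (+ 2 * P₁ - P₂)
    first-term = trans (*-identityˡ _) (cong ((d 0 - - + 2) *_) (det-fully-Reduced m (d ∘ suc)))

    last-minor : det (suc m) (minor A last) ≡ ∏ (suc m) (λ i → - + 1 - d (suc i))
    last-minor = trans (det-cong (suc m) entrywise) (det-SubdiagonalDifferences (suc m) d)
      where
      entrywise : ∀ r c → minor A last r c ≡ SubdiagonalDifferences d (suc m) r c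
      entrywise r c rewrite toℕ-punchIn-fromℕ c | <⇒<ᵇ≡true (toℕ c) (suc m) (toℕ<n c) = refl

    last-entry : A zero last ≡ - + 2
    last-entry rewrite toℕ-fromℕ m | ≥⇒<ᵇ≡false m m ≤-refl = refl

    last-term : expansionTerm A last ≡ - + 2 * P₁
    last-term = begin
      sgn (toℕ last) * (A zero last * det (suc m) (minor A last))
        ≡⟨ cong₂ (λ g x → g * x) (cong sgn (toℕ-fromℕ (suc m))) (cong₂ _*_ last-entry last-minor) ⟩
      sgn (suc m) * (- + 2 * ∏ (suc m) (λ i → - + 1 - d (suc i)))
        ≡⟨ *-left-commute (sgn (suc m)) (- + 2) _ ⟩
      - + 2 * (sgn (suc m) * ∏ (suc m) (λ i → - + 1 - d (suc i)))
        ≡⟨ cong (- + 2 *_) (sgn-∏-negate (suc m) (d ∘ suc)) ⟩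
      - + 2 * P₁ ∎
      where
      *-left-commute : ∀ a b c → a * (b * c) ≡ b * (a * c)
      *-left-commute = solve-∀

  det-Laplacian : ∀ n d → det n (Laplacian d n) ≡
                  + 2 * ∏ n (λ i → d i + + 1) - ∏ n (λ i → d i + + 2)
  det-Laplacian zero    d = refl
  det-Laplacian (suc m) d = trans (sym (det-Reduced d (suc m) m (n<1+n m))) (det-fully-Reduced m d)

module CatalanArithmetic where

  open import Data.Nat
  open import Data.Nat.Properties
  open import Data.Nat.Combinatorics using (_C_; k![n∸k]!∣n!)
  open import Data.Nat.Combinatorics.Specification using (nCk≡n!/k![n-k]!)
  open import Data.Nat.DivMod using (_/_; m/n*n≡m; m*n/n≡m)
  open import Data.Nat.Tactic.RingSolver using (solve-∀)
  open import Relation.Binary.PropositionalEquality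
  open ≡-Reasoning

  ∏ℕ : ℕ → (ℕ → ℕ) → ℕ
  ∏ℕ zero    f = 1
  ∏ℕ (suc k) f = f 0 * ∏ℕ k (λ i → f (suc i))

  ∏ℕ-falling : ∀ k b (f : ℕ → ℕ) → (∀ i → i < k → f i ≡ b + k ∸ i) → ∏ℕ k f * b ! ≡ (b + k) !
  ∏ℕ-falling zero    b f _   = trans (*-identityˡ (b !)) (cong _! (sym (+-identityʳ b)))
  ∏ℕ-falling (suc k) b f f≡ = begin
    f 0 * ∏ℕ k (λ i → f (suc i)) * b !   ≡⟨ *-assoc (f 0) _ (b !) ⟩
    f 0 * (∏ℕ k (λ i → f (suc i)) * b !) ≡⟨ cong₂ _*_ (trans (f≡ 0 (s≤s z≤n)) (+-suc b k)) tail ⟩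
    suc (b + k) * (b + k) !              ≡⟨ cong _! (+-suc b k) ⟨
    (b + suc k) !                        ∎
    where
    tail : ∏ℕ k (λ i → f (suc i)) * b ! ≡ (b + k) !
    tail = ∏ℕ-falling k b (λ i → f (suc i))
                      (λ i i<k → trans (f≡ (suc i) (s≤s i<k)) (cong (_∸ suc i) (+-suc b k)))

  C-mul-factorials : ∀ N k → k ≤ N → (N C k) * (k ! * (N ∸ k) !) ≡ N !
  C-mul-factorials N k k≤N = trans (cong (_* (k ! * (N ∸ k) !)) (nCk≡n!/k![n-k]! k≤N))
                                   (m/n*n≡m {{k !* (N ∸ k) !≢0}} (k![n∸k]!∣n! k≤N))

  module _ (n : ℕ) where

    private
      N = 2 * suc n

      N≡2+2n : N ≡ suc (suc (2 * n))
      N≡2+2n = cong suc (+-suc n (n + 0))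

    central-binomial : (N C suc n) * (suc n ! * suc n !) ≡ N !
    central-binomial = subst (λ m → (N C suc n) * (suc n ! * m !) ≡ N !) N∸[1+n]≡1+n
                             (C-mul-factorials N (suc n) (m≤m+n (suc n) _))
      where
      N∸[1+n]≡1+n : N ∸ suc n ≡ suc n
      N∸[1+n]≡1+n = trans (m+n∸m≡n (suc n) (suc n + 0)) (+-identityʳ (suc n))

    next-binomial : (N C suc (suc n)) * (suc (suc n) ! * n !) ≡ N !
    next-binomial = subst (λ m → (N C suc (suc n)) * (suc (suc n) ! * m !) ≡ N !) N∸[2+n]≡n
                          (C-mul-factorials N (suc (suc n))
                            (subst (suc (suc n) ≤_) (sym N≡2+2n) (s≤s (s≤s (m≤m+n n _)))))
      where
      N∸[2+n]≡n : N ∸ suc (suc n) ≡ n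
      N∸[2+n]≡n = trans (cong (λ m → suc n + m ∸ suc (suc n)) (+-identityʳ (suc n))) (m+n∸n≡m n (suc n))

    binomial-ratio : (N C suc n) * suc n ≡ (N C suc (suc n)) * suc (suc n)
    binomial-ratio = *-cancelʳ-≡ _ _ (suc n ! * n !) {{m*n≢0 (suc n !) (n !) {{suc n !≢0}} {{n !≢0}}}} (begin
      (N C suc n) * suc n * (suc n ! * n !)           ≡⟨ regroup (N C suc n) (suc n) (n !) ⟩
      (N C suc n) * (suc n ! * suc n !)               ≡⟨ central-binomial ⟩
      N !                                             ≡⟨ next-binomial ⟨
      (N C suc (suc n)) * (suc (suc n) ! * n !)       ≡⟨ regroup′ (N C suc (suc n)) (suc n) (n !) ⟩
      (N C suc (suc n)) * suc (suc n) * (suc n ! * n !) ∎)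
      where
      regroup : ∀ b m a → b * m * (m * a * a) ≡ b * (m * a * (m * a))
      regroup = solve-∀
      regroup′ : ∀ b m a → b * ((1 + m) * (m * a) * a) ≡ b * (1 + m) * (m * a * a)
      regroup′ = solve-∀

    catalan-quotient-exact : catalan (suc n) * suc (suc n) ≡ N C suc n
    catalan-quotient-exact = trans (cong (_* suc (suc n)) catalan≡difference) difference-mul
      where
      B  = N C suc n
      B′ = N C suc (suc n)
      difference-mul : (B ∸ B′) * suc (suc n) ≡ B
      difference-mul = begin
        (B ∸ B′) * suc (suc n)         ≡⟨ *-distribʳ-∸ (suc (suc n)) B B′ ⟩
        B * suc (suc n) ∸ B′ * suc (suc n) ≡⟨ cong₂ _∸_ (*-suc B (suc n)) (sym binomial-ratio) ⟩
        B + B * suc n ∸ B * suc n      ≡⟨ m+n∸n≡m B (B * suc n) ⟩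
        B                              ∎
      catalan≡difference : catalan (suc n) ≡ B ∸ B′
      catalan≡difference = trans (cong (_/ suc (suc n)) (sym difference-mul)) (m*n/n≡m (B ∸ B′) (suc (suc n)))

    factorial-catalan : n ! * catalan (suc n) * suc (suc n) ! ≡ 2 * suc (2 * n) !
    factorial-catalan = *-cancelʳ-≡ _ _ (suc n) (begin
      n ! * K * suc (suc n) ! * suc n                 ≡⟨ regroup (n !) K n ⟩
      K * suc (suc n) * (suc n ! * suc n !)           ≡⟨ cong (_* (suc n ! * suc n !)) catalan-quotient-exact ⟩
      (N C suc n) * (suc n ! * suc n !)               ≡⟨ central-binomial ⟩
      N !                                             ≡⟨ cong _! N≡2+2n ⟩
      suc (suc (2 * n)) * suc (2 * n) !               ≡⟨ regroup′ n (suc (2 * n) !) ⟩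
      2 * suc (2 * n) ! * suc n                       ∎)
      where
      K = catalan (suc n)
      regroup : ∀ a K n → a * K * ((2 + n) * ((1 + n) * a)) * (1 + n) ≡ K * (2 + n) * ((1 + n) * a * ((1 + n) * a))
      regroup = solve-∀
      regroup′ : ∀ n F → (2 + 2 * n) * F ≡ 2 * F * (1 + n)
      regroup′ = solve-∀

  ∏ℕ-shifted-falling : ∀ n c → ∏ℕ n (λ i → 2 * n ∸ i + c) * (c + n) ! ≡ (c + 2 * n) !
  ∏ℕ-shifted-falling n c = trans (∏ℕ-falling n (c + n) _ shifted) (cong _! c+n+n≡c+2n)
    where
    c+n+n≡c+2n : c + n + n ≡ c + 2 * n
    c+n+n≡c+2n = trans (+-assoc c n n) (cong (λ m → c + (n + m)) (sym (+-identityʳ n)))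
    shifted : ∀ i → i < n → 2 * n ∸ i + c ≡ c + n + n ∸ i
    shifted i i<n = begin
      2 * n ∸ i + c   ≡⟨ +-comm (2 * n ∸ i) c ⟩
      c + (2 * n ∸ i) ≡⟨ +-∸-assoc c (≤-trans (<⇒≤ i<n) (m≤m+n n (n + 0))) ⟨
      c + 2 * n ∸ i   ≡⟨ cong (λ m → c + (n + m) ∸ i) (+-identityʳ n) ⟩
      c + (n + n) ∸ i ≡⟨ cong (_∸ i) (+-assoc c n n) ⟨
      c + n + n ∸ i   ∎

  catalan-from-products : ∀ n →
    2 * ∏ℕ n (λ i → 2 * n ∸ i + 1) ≡ ∏ℕ n (λ i → 2 * n ∸ i + 2) + n ! * catalan (suc n)
  catalan-from-products n = *-cancelʳ-≡ _ _ (suc (suc n) !) {{suc (suc n) !≢0}} (begin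
    2 * P₁ * suc (suc n) !                            ≡⟨ regroup P₁ n (n !) ⟩
    2 * suc (suc n) * (P₁ * suc n !)                  ≡⟨ cong (2 * suc (suc n) *_) (∏ℕ-shifted-falling n 1) ⟩
    2 * suc (suc n) * suc (2 * n) !                   ≡⟨ split n (suc (2 * n) !) ⟩
    suc (suc (2 * n)) * suc (2 * n) ! + 2 * suc (2 * n) !
      ≡⟨ cong₂ _+_ (∏ℕ-shifted-falling n 2) (factorial-catalan n) ⟨
    P₂ * suc (suc n) ! + n ! * catalan (suc n) * suc (suc n) ! ≡⟨ *-distribʳ-+ (suc (suc n) !) P₂ _ ⟨
    (P₂ + n ! * catalan (suc n)) * suc (suc n) !      ∎)
    where
    P₁ = ∏ℕ n (λ i → 2 * n ∸ i + 1)
    P₂ = ∏ℕ n (λ i → 2 * n ∸ i + 2)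
    regroup : ∀ p n a → 2 * p * ((2 + n) * ((1 + n) * a)) ≡ 2 * (2 + n) * (p * ((1 + n) * a))
    regroup = solve-∀
    split : ∀ n F → 2 * (2 + n) * F ≡ (2 + 2 * n) * F + 2 * F
    split = solve-∀

open ColumnReduction using (∏; det-Laplacian)
open CatalanArithmetic using (∏ℕ; catalan-from-products)
open import Data.Nat using (ℕ; zero; suc; _≥_; _+_; _*_; _∸_; _!)
open import Data.Nat.Properties using (m≤m+n; m+n∸m≡n)
open import Data.Integer as ℤ using (+_)
open import Data.Integer.Properties using (pos-+; pos-*; [+m]-[+n]≡m⊖n; ≤-⊖)
open import Relation.Binary.PropositionalEquality using (_≡_; refl; sym; trans; cong; cong₂; module ≡-Reasoning)
open ≡-Reasoning

∏-pos : ∀ k {f : ℕ → ℤ.ℤ} {g : ℕ → ℕ} → (∀ i → f i ≡ + g i) → ∏ k f ≡ + ∏ℕ k g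
∏-pos zero    f≡g = refl
∏-pos (suc k) {g = g} f≡g = trans (cong₂ ℤ._*_ (f≡g 0) (∏-pos k (λ i → f≡g (suc i)))) (sym (pos-* (g 0) _))

+[m+n]-+m≡+n : ∀ m n → + (m + n) ℤ.- + m ≡ + n
+[m+n]-+m≡+n m n = trans ([+m]-[+n]≡m⊖n (m + n) m) (trans (≤-⊖ (m≤m+n m n)) (cong +_ (m+n∸m≡n m n)))

mainTheorem11 : (n : ℕ) → n ≥ 1 → det n (L' n) ≡ + ((n !) * catalan (suc n))
mainTheorem11 n _ = begin
  det n (L' n)
    -- L' n is definitionally Laplacian (λ i → + (2 * n ∸ i)) n.
    ≡⟨ det-Laplacian n (λ i → + (2 * n ∸ i)) ⟩
  + 2 ℤ.* ∏ n (λ i → + (2 * n ∸ i) ℤ.+ + 1) ℤ.- ∏ n (λ i → + (2 * n ∸ i) ℤ.+ + 2)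
    ≡⟨ cong₂ (λ p q → + 2 ℤ.* p ℤ.- q) (∏-pos n (λ _ → sym (pos-+ _ 1))) (∏-pos n (λ _ → sym (pos-+ _ 2))) ⟩
  + 2 ℤ.* + P₁ ℤ.- + P₂
    ≡⟨ cong (λ p → p ℤ.- + P₂) (sym (pos-* 2 P₁)) ⟩
  + (2 * P₁) ℤ.- + P₂
    ≡⟨ cong (λ m → + m ℤ.- + P₂) (catalan-from-products n) ⟩
  + (P₂ + n ! * catalan (suc n)) ℤ.- + P₂
    ≡⟨ +[m+n]-+m≡+n P₂ _ ⟩
  + (n ! * catalan (suc n)) ∎
  where
  P₁ = ∏ℕ n (λ i → 2 * n ∸ i + 1)
  P₂ = ∏ℕ n (λ i → 2 * n ∸ i + 2)
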